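{- For all integers $n,m\ge0$, \[ q^{ -v_{n,m}}\,\mathfrak{B}_{n,m}(q)=\begin{bmatrix}n+m\\ n\end{bmatrix}_q . \]
   Context: Let $R_{n,m}$ be the set of words in $\{N,E\}$ with $n$ letters $N$ and $m$ letters $E$, viewed as lattice paths from $(0,0)$ with $N$ a unit step in one coordinate and $E$ a unit step in the other; write $(x,y)$ for the starting point of a step, where $x$ counts the $E$-steps and $y$ the $N$-steps taken before it. For an $E$-step starting at $(x,y)$ put $d=(n-y)+(m-x)$ and define its weight $w'_{n,m}(e)=-(d-1)/2$ if $d$ is odd and $w'_{n,m}(e)=d/2$ if $d$ is even. For $P\in R_{n,m}$ let $w'(P)$ be the sum of the weights of its $E$-steps, and $\mathfrak{B}_{n,m}(q)=\sum_{P\in R_{n,m}}q^{w'(P)}$. Let $D_{n,m}=\lfloor (n-m+1)/2\rfloor$ and $v_{n,m}=-\sum_{k=D_{n,m}}^{D_{n,m}+m-1}k$. The $q$-binomial coefficient is $\begin{bmatrix}a\\ b\end{bmatrix}_q=\frac{[a]_q!}{[b]_q![a-b]_q!}$ with $[k]_q=1+q+\cdots+q^{k-1}$ and $[k]_q!=[1]_q\cdots[k]_q$. -}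

module Defs where

open import Data.Nat as ℕ using (ℕ; zero; suc)
open import Data.Integer as ℤ using (ℤ; +_; _/ℕ_)
open import Data.Bool using (Bool; true; false; if_then_else_)
open import Data.List using (List; []; _∷_; _++_; map; concatMap; filter; sum; length; upTo; foldr)
open import Data.Product using (_×_; _,_)
open import Relation.Nullary.Decidable using (does)
open import Relation.Binary.PropositionalEquality using (_≡_)

-- Laurent polynomials in q with integer coefficients, as finite formal
-- sums of monomials  c · q^e  (pairs (c , e)).  Two Laurent polynomials
-- are equal iff all their coefficients agree.

Laurent : Set
Laurent = List (ℤ × ℤ)

mono : ℤ → ℤ → Laurent
mono c e = (c , e) ∷ []

0L : Laurent
0L = []

1L : Laurent
1L = mono (+ 1) (+ 0)

infixl 6 _+L_
infixl 7 _*L_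

_+L_ : Laurent → Laurent → Laurent
_+L_ = _++_

_*L_ : Laurent → Laurent → Laurent
p *L r = concatMap (λ { (c , e) → map (λ { (c' , e') → (c ℤ.* c' , e ℤ.+ e') }) r }) p

coeff : Laurent → ℤ → ℤ
coeff [] k = + 0
coeff ((c , e) ∷ p) k = (if does (e ℤ.≟ k) then c else + 0) ℤ.+ coeff p k

infix 4 _≈L_
_≈L_ : Laurent → Laurent → Set
p ≈L r = ∀ k → coeff p k ≡ coeff r k

qpow : ℤ → Laurent
qpow e = mono (+ 1) e

sumL : List Laurent → Laurent
sumL = foldr _+L_ 0L

prodL : List Laurent → Laurent
prodL = foldr _*L_ 1L

qint : ℕ → Laurent
qint k = sumL (map (λ i → qpow (+ i)) (upTo k))

qfact : ℕ → Laurent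
qfact k = prodL (map (λ i → qint (suc i)) (upTo k))

data Step : Set where
  N E : Step

Word : Set
Word = List Step

allWords : ℕ → List Word
allWords zero = [] ∷ []
allWords (suc k) = map (N ∷_) (allWords k) ++ map (E ∷_) (allWords k)

countN : Word → ℕ
countN [] = 0
countN (N ∷ w) = suc (countN w)
countN (E ∷ w) = countN w

R : ℕ → ℕ → List Word
R n m = filter (λ w → countN w ℕ.≟ n) (allWords (n ℕ.+ m))

-- weight of an E-step with d = (n-y)+(m-x):
--   -(d-1)/2 if d odd,  d/2 if d even   (i.e. -⌊d/2⌋ resp. d/2)
stepWeight : ℕ → ℤ
stepWeight d = if does (d ℕ.% 2 ℕ.≟ 0) then + (d ℕ./ 2) else ℤ.- (+ ((d ℕ.∸ 1) ℕ./ 2))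

weightFrom : ℕ → ℕ → ℕ → ℕ → Word → ℤ
weightFrom n m x y [] = + 0
weightFrom n m x y (N ∷ w) = weightFrom n m x (suc y) w
weightFrom n m x y (E ∷ w) =
  stepWeight ((n ℕ.∸ y) ℕ.+ (m ℕ.∸ x)) ℤ.+ weightFrom n m (suc x) y w

w' : ℕ → ℕ → Word → ℤ
w' n m P = weightFrom n m 0 0 P

𝔅 : ℕ → ℕ → Laurent
𝔅 n m = sumL (map (λ P → qpow (w' n m P)) (R n m))

D : ℕ → ℕ → ℤ
D n m = ((+ n ℤ.- + m) ℤ.+ + 1) /ℕ 2

v : ℕ → ℕ → ℤ
v n m = ℤ.- sum′ (map (λ i → D n m ℤ.+ + i) (upTo m))
  where
  sum′ : List ℤ → ℤ
  sum′ = foldr ℤ._+_ (+ 0)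

-- Splitting the paths of R_{n+1,m+1} by their first step gives
--   𝔅_{n+1,m+1} = 𝔅_{n,m+1} + q^w 𝔅_{n+1,m},
-- where w is the weight of an initial E-step (d = n + m + 2). Since -v_{n,m} is the sum of the
-- m consecutive integers starting at D_{n,m}, and D moves by 0 or 1 with each step according to
-- parity, K_{n,m} = q^{-v_{n,m}} 𝔅_{n,m} satisfies q-Pascal's rule
--   K_{n+1,m+1} = K_{n,m+1} + q^{n+1} K_{n+1,m}    if n + m is even,
--   K_{n+1,m+1} = q^{m+1} K_{n,m+1} + K_{n+1,m}    if n + m is odd,
-- with K = 1 on the boundary. Both forms match [a+b]_q = [a]_q + q^a [b]_q, so by induction
-- K_{n,m} [n]_q! [m]_q! = [n+m]_q!.
module Submission where

open import Defs
open import Data.Nat as ℕ using (ℕ; zero; suc)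
open import Data.Integer as ℤ using (ℤ; +_)
open import Data.List using (List; []; _∷_; _++_; _∷ʳ_; map; foldr; upTo)
import Data.List.Properties as Listₚ
import Data.Nat.Properties as ℕₚ
open import Data.Sum using (_⊎_; inj₁; inj₂; [_,_]′)
open import Function.Base using (_∘_; id)
open import Algebra.Bundles using (Monoid; CommutativeSemiring)
import Relation.Binary.Reasoning.Setoid as SetoidReasoning
open import Data.Product using (_×_; _,_)
open import Relation.Binary.PropositionalEquality using (_≡_; refl; sym; trans; cong; cong₂; module ≡-Reasoning)
open import Tactic.RingSolver.Core.AlmostCommutativeRing using (AlmostCommutativeRing; fromCommutativeSemiring)
open import Data.Maybe using (nothing)
open import Level using (0ℓ)

module MonoidFolds {c ℓ} (M : Monoid c ℓ) where

  open Monoid M using (Carrier; _≈_; _∙_; ε; setoid; ∙-congˡ; assoc; identityˡ; identityʳ)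
  open SetoidReasoning setoid

  foldr-∷ʳ : ∀ xs x → foldr _∙_ ε (xs ∷ʳ x) ≈ foldr _∙_ ε xs ∙ x
  foldr-∷ʳ [] x = begin
    x ∙ ε  ≈⟨ identityʳ x ⟩
    x      ≈⟨ identityˡ x ⟨
    ε ∙ x  ∎
  foldr-∷ʳ (y ∷ xs) x = begin
    y ∙ foldr _∙_ ε (xs ∷ʳ x)    ≈⟨ ∙-congˡ (foldr-∷ʳ xs x) ⟩
    y ∙ (foldr _∙_ ε xs ∙ x)     ≈⟨ assoc y _ x ⟨
    (y ∙ foldr _∙_ ε xs) ∙ x     ∎

  foldr-map-upTo-suc : ∀ (f : ℕ → Carrier) k →
    foldr _∙_ ε (map f (upTo (suc k))) ≈ foldr _∙_ ε (map f (upTo k)) ∙ f k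
  foldr-map-upTo-suc f k = begin
    foldr _∙_ ε (map f (upTo (suc k)))        ≡⟨ cong (foldr _∙_ ε ∘ map f) (Listₚ.applyUpTo-∷ʳ id k) ⟨
    foldr _∙_ ε (map f (upTo k ∷ʳ k))         ≡⟨ cong (foldr _∙_ ε) (Listₚ.map-++ f (upTo k) (k ∷ [])) ⟩
    foldr _∙_ ε (map f (upTo k) ∷ʳ f k)       ≈⟨ foldr-∷ʳ (map f (upTo k)) (f k) ⟩
    foldr _∙_ ε (map f (upTo k)) ∙ f k        ∎

module LaurentSemiring where

  open import Data.Bool using (true; false; if_then_else_)
  open import Data.Integer using (_+_; _*_; _-_; _≟_)
  import Data.Integer.Properties as ℤₚ
  open import Data.Integer.Tactic.RingSolver using (solve-∀)
  open import Function.Bundles using (_⇔_; mk⇔)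
  open import Relation.Nullary.Decidable using (does; does-⇔)
  open import Relation.Binary.Bundles using (Setoid)

  infix 4 _≋_

  -- A record rather than _≈L_ itself, so that both polynomials can be recovered from the type
  -- by unification.
  record _≋_ (p r : Laurent) : Set where
    constructor mk≋
    field coeff-≡ : p ≈L r

  open _≋_ public

  ≋-refl : ∀ {p} → p ≋ p
  ≋-refl = mk≋ λ _ → refl

  ≋-sym : ∀ {p r} → p ≋ r → r ≋ p
  ≋-sym (mk≋ h) = mk≋ λ k → sym (h k)

  ≋-trans : ∀ {p r s} → p ≋ r → r ≋ s → p ≋ s
  ≋-trans (mk≋ h) (mk≋ g) = mk≋ λ k → trans (h k) (g k)

  ≡⇒≋ : ∀ {p r} → p ≡ r → p ≋ r
  ≡⇒≋ refl = ≋-refl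

  ≋-setoid : Setoid 0ℓ 0ℓ
  ≋-setoid = record
    { Carrier = Laurent
    ; _≈_ = _≋_
    ; isEquivalence = record { refl = ≋-refl ; sym = ≋-sym ; trans = ≋-trans }
    }

  module ≋-Reasoning = SetoidReasoning ≋-setoid

  coeff-+L : ∀ p r k → coeff (p +L r) k ≡ coeff p k + coeff r k
  coeff-+L [] r k = sym (ℤₚ.+-identityˡ _)
  coeff-+L ((c , e) ∷ p) r k = trans (cong (λ z → t + z) (coeff-+L p r k)) (sym (ℤₚ.+-assoc t _ _))
    where t = if does (e ≟ k) then c else + 0

  +L-cong : ∀ {p p′ r r′} → p ≋ p′ → r ≋ r′ → p +L r ≋ p′ +L r′
  +L-cong {p} {p′} {r} {r′} (mk≋ h) (mk≋ g) = mk≋ λ k → begin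
    coeff (p +L r) k         ≡⟨ coeff-+L p r k ⟩
    coeff p k + coeff r k    ≡⟨ cong₂ _+_ (h k) (g k) ⟩
    coeff p′ k + coeff r′ k  ≡⟨ coeff-+L p′ r′ k ⟨
    coeff (p′ +L r′) k       ∎
    where open ≡-Reasoning

  +L-congˡ : ∀ p {r r′} → r ≋ r′ → p +L r ≋ p +L r′
  +L-congˡ p = +L-cong (≋-refl {p})

  +L-congʳ : ∀ r {p p′} → p ≋ p′ → p +L r ≋ p′ +L r
  +L-congʳ r p≋p′ = +L-cong p≋p′ (≋-refl {r})

  +L-comm : ∀ p r → p +L r ≋ r +L p
  +L-comm p r = mk≋ λ k → begin
    coeff (p +L r) k       ≡⟨ coeff-+L p r k ⟩
    coeff p k + coeff r k  ≡⟨ ℤₚ.+-comm (coeff p k) _ ⟩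
    coeff r k + coeff p k  ≡⟨ coeff-+L r p k ⟨
    coeff (r +L p) k       ∎
    where open ≡-Reasoning

  +L-assoc : ∀ p r s → (p +L r) +L s ≋ p +L (r +L s)
  +L-assoc p r s = ≡⇒≋ (Listₚ.++-assoc p r s)

  +L-identityʳ : ∀ p → p +L 0L ≋ p
  +L-identityʳ p = ≡⇒≋ (Listₚ.++-identityʳ p)

  ∷-cong : ∀ {x x′ p p′} → x ≡ x′ → p ≋ p′ → x ∷ p ≋ x′ ∷ p′
  ∷-cong {c , e} refl (mk≋ h) = mk≋ λ k → cong (λ z → (if does (e ≟ k) then c else + 0) + z) (h k)

  i+j≡k⇔j≡k-i : ∀ i j k → (i + j ≡ k) ⇔ (j ≡ k - i)
  i+j≡k⇔j≡k-i i j k = mk⇔ (λ { refl → cancelˡ i j }) (λ { refl → cancelʳ i k })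
    where
    cancelˡ : ∀ i j → j ≡ i + j - i
    cancelˡ = solve-∀
    cancelʳ : ∀ i k → i + (k - i) ≡ k
    cancelʳ = solve-∀

  *-distrib-if-0 : ∀ c c′ b → (if b then c * c′ else + 0) ≡ c * (if b then c′ else + 0)
  *-distrib-if-0 c c′ true  = refl
  *-distrib-if-0 c c′ false = sym (ℤₚ.*-zeroʳ c)

  coeff-mono-*L : ∀ c e r k → coeff (mono c e *L r) k ≡ c * coeff r (k - e)
  coeff-mono-*L c e [] k = sym (ℤₚ.*-zeroʳ c)
  coeff-mono-*L c e ((c′ , e′) ∷ r) k = begin
    (if does (e + e′ ≟ k) then c * c′ else + 0) + coeff (mono c e *L r) k
      ≡⟨ cong₂ _+_ (cong (λ b → if b then c * c′ else + 0) same-test) (coeff-mono-*L c e r k) ⟩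
    (if does (e′ ≟ k - e) then c * c′ else + 0) + c * coeff r (k - e)
      ≡⟨ cong (_+ c * coeff r (k - e)) (*-distrib-if-0 c c′ _) ⟩
    c * (if does (e′ ≟ k - e) then c′ else + 0) + c * coeff r (k - e)
      ≡⟨ ℤₚ.*-distribˡ-+ c _ _ ⟨
    c * coeff ((c′ , e′) ∷ r) (k - e) ∎
    where
    open ≡-Reasoning
    same-test : does (e + e′ ≟ k) ≡ does (e′ ≟ k - e)
    same-test = does-⇔ (i+j≡k⇔j≡k-i e e′ k) (e + e′ ≟ k) (e′ ≟ k - e)

  +L-interchange : ∀ a b c d → (a +L b) +L (c +L d) ≋ (a +L c) +L (b +L d)
  +L-interchange a b c d = mk≋ λ k → begin
    coeff ((a +L b) +L (c +L d)) k
      ≡⟨ trans (coeff-+L (a +L b) _ k) (cong₂ _+_ (coeff-+L a b k) (coeff-+L c d k)) ⟩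
    (coeff a k + coeff b k) + (coeff c k + coeff d k)
      ≡⟨ swap (coeff a k) (coeff b k) (coeff c k) (coeff d k) ⟩
    (coeff a k + coeff c k) + (coeff b k + coeff d k)
      ≡⟨ trans (coeff-+L (a +L c) _ k) (cong₂ _+_ (coeff-+L a c k) (coeff-+L b d k)) ⟨
    coeff ((a +L c) +L (b +L d)) k ∎
    where
    open ≡-Reasoning
    swap : ∀ w x y z → (w + x) + (y + z) ≡ (w + y) + (x + z)
    swap = solve-∀

  ∷-*L : ∀ c e p r → ((c , e) ∷ p) *L r ≡ mono c e *L r +L p *L r
  ∷-*L c e p r = cong (_++ (p *L r)) (sym (Listₚ.++-identityʳ _))

  mono-*L-cong : ∀ c e {r r′} → r ≋ r′ → mono c e *L r ≋ mono c e *L r′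
  mono-*L-cong c e {r} {r′} (mk≋ h) = mk≋ λ k → begin
    coeff (mono c e *L r) k   ≡⟨ coeff-mono-*L c e r k ⟩
    c * coeff r (k - e)       ≡⟨ cong (c *_) (h (k - e)) ⟩
    c * coeff r′ (k - e)      ≡⟨ coeff-mono-*L c e r′ k ⟨
    coeff (mono c e *L r′) k  ∎
    where open ≡-Reasoning

  mono-*L-distribˡ : ∀ c e r s → mono c e *L (r +L s) ≋ mono c e *L r +L mono c e *L s
  mono-*L-distribˡ c e r s = mk≋ λ k → begin
    coeff (mono c e *L (r +L s)) k
      ≡⟨ coeff-mono-*L c e (r +L s) k ⟩
    c * coeff (r +L s) (k - e)
      ≡⟨ cong (c *_) (coeff-+L r s (k - e)) ⟩
    c * (coeff r (k - e) + coeff s (k - e))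
      ≡⟨ ℤₚ.*-distribˡ-+ c _ _ ⟩
    c * coeff r (k - e) + c * coeff s (k - e)
      ≡⟨ cong₂ _+_ (coeff-mono-*L c e r k) (coeff-mono-*L c e s k) ⟨
    coeff (mono c e *L r) k + coeff (mono c e *L s) k
      ≡⟨ coeff-+L (mono c e *L r) _ k ⟨
    coeff (mono c e *L r +L mono c e *L s) k ∎
    where open ≡-Reasoning

  *L-congˡ : ∀ p {r r′} → r ≋ r′ → p *L r ≋ p *L r′
  *L-congˡ [] r≋r′ = ≋-refl
  *L-congˡ ((c , e) ∷ p) {r} {r′} r≋r′ = ≋-trans (≡⇒≋ (∷-*L c e p r))
    (≋-trans (+L-cong (mono-*L-cong c e r≋r′) (*L-congˡ p r≋r′)) (≡⇒≋ (sym (∷-*L c e p r′))))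

  *L-distribˡ : ∀ p r s → p *L (r +L s) ≋ p *L r +L p *L s
  *L-distribˡ [] r s = ≋-refl
  *L-distribˡ ((c , e) ∷ p) r s = begin
    ((c , e) ∷ p) *L (r +L s)                             ≡⟨ ∷-*L c e p (r +L s) ⟩
    mono c e *L (r +L s) +L p *L (r +L s)                 ≈⟨ +L-cong (mono-*L-distribˡ c e r s) (*L-distribˡ p r s) ⟩
    (mono c e *L r +L mono c e *L s) +L (p *L r +L p *L s) ≈⟨ +L-interchange (mono c e *L r) _ (p *L r) _ ⟩
    (mono c e *L r +L p *L r) +L (mono c e *L s +L p *L s) ≡⟨ cong₂ _+L_ (∷-*L c e p r) (∷-*L c e p s) ⟨
    ((c , e) ∷ p) *L r +L ((c , e) ∷ p) *L s               ∎
    where open ≋-Reasoning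

  *L-distribʳ : ∀ p r s → (p +L r) *L s ≡ p *L s +L r *L s
  *L-distribʳ p r s = Listₚ.concatMap-++ _ p r

  *L-zeroʳ : ∀ p → p *L 0L ≡ 0L
  *L-zeroʳ []      = refl
  *L-zeroʳ (_ ∷ p) = *L-zeroʳ p

  *L-identityˡ : ∀ p → 1L *L p ≋ p
  *L-identityˡ [] = ≋-refl
  *L-identityˡ ((c , e) ∷ p) = ∷-cong (cong₂ _,_ (ℤₚ.*-identityˡ c) (ℤₚ.+-identityˡ e)) (*L-identityˡ p)

  mono-*L-comm : ∀ c e r → r *L mono c e ≋ mono c e *L r
  mono-*L-comm c e [] = ≋-refl
  mono-*L-comm c e ((c′ , e′) ∷ r) =
    ∷-cong (cong₂ _,_ (ℤₚ.*-comm c′ c) (ℤₚ.+-comm e′ e)) (mono-*L-comm c e r)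

  *L-comm : ∀ p r → p *L r ≋ r *L p
  *L-comm [] r = ≡⇒≋ (sym (*L-zeroʳ r))
  *L-comm ((c , e) ∷ p) r = begin
    ((c , e) ∷ p) *L r          ≡⟨ ∷-*L c e p r ⟩
    mono c e *L r +L p *L r     ≈⟨ +L-cong (≋-sym (mono-*L-comm c e r)) (*L-comm p r) ⟩
    r *L mono c e +L r *L p     ≈⟨ *L-distribˡ r (mono c e) p ⟨
    r *L ((c , e) ∷ p)          ∎
    where open ≋-Reasoning

  mono-*L-mono : ∀ a e b f s → mono a e *L (mono b f *L s) ≋ mono (a * b) (e + f) *L s
  mono-*L-mono a e b f [] = ≋-refl
  mono-*L-mono a e b f ((c , g) ∷ s) =
    ∷-cong (cong₂ _,_ (sym (ℤₚ.*-assoc a b c)) (sym (ℤₚ.+-assoc e f g))) (mono-*L-mono a e b f s)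

  mono-*L-assoc : ∀ a e r s → (mono a e *L r) *L s ≋ mono a e *L (r *L s)
  mono-*L-assoc a e [] s = ≋-refl
  mono-*L-assoc a e ((b , f) ∷ r) s = begin
    (mono a e *L ((b , f) ∷ r)) *L s                        ≡⟨ ∷-*L (a * b) (e + f) (mono a e *L r) s ⟩
    mono (a * b) (e + f) *L s +L (mono a e *L r) *L s
      ≈⟨ +L-cong (≋-sym (mono-*L-mono a e b f s)) (mono-*L-assoc a e r s) ⟩
    mono a e *L (mono b f *L s) +L mono a e *L (r *L s)     ≈⟨ *L-distribˡ (mono a e) (mono b f *L s) (r *L s) ⟨
    mono a e *L (mono b f *L s +L r *L s)                   ≡⟨ cong (mono a e *L_) (∷-*L b f r s) ⟨
    mono a e *L (((b , f) ∷ r) *L s)                        ∎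
    where open ≋-Reasoning

  *L-assoc : ∀ p r s → (p *L r) *L s ≋ p *L (r *L s)
  *L-assoc [] r s = ≋-refl
  *L-assoc ((c , e) ∷ p) r s = begin
    (((c , e) ∷ p) *L r) *L s                  ≡⟨ cong (_*L s) (∷-*L c e p r) ⟩
    (mono c e *L r +L p *L r) *L s             ≡⟨ *L-distribʳ (mono c e *L r) (p *L r) s ⟩
    (mono c e *L r) *L s +L (p *L r) *L s      ≈⟨ +L-cong (mono-*L-assoc c e r s) (*L-assoc p r s) ⟩
    mono c e *L (r *L s) +L p *L (r *L s)      ≡⟨ ∷-*L c e p (r *L s) ⟨
    ((c , e) ∷ p) *L (r *L s)                  ∎
    where open ≋-Reasoning

  *L-identityʳ : ∀ p → p *L 1L ≋ p
  *L-identityʳ p = ≋-trans (*L-comm p 1L) (*L-identityˡ p)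

  *L-congʳ : ∀ {p p′} r → p ≋ p′ → p *L r ≋ p′ *L r
  *L-congʳ {p} {p′} r p≋p′ = ≋-trans (*L-comm p r) (≋-trans (*L-congˡ r p≋p′) (*L-comm r p′))

  *L-cong : ∀ {p p′ r r′} → p ≋ p′ → r ≋ r′ → p *L r ≋ p′ *L r′
  *L-cong {p′ = p′} {r} p≋p′ r≋r′ = ≋-trans (*L-congʳ r p≋p′) (*L-congˡ p′ r≋r′)

  laurent-commutativeSemiring : CommutativeSemiring 0ℓ 0ℓ
  laurent-commutativeSemiring = record
    { Carrier = Laurent ; _≈_ = _≋_ ; _+_ = _+L_ ; _*_ = _*L_ ; 0# = 0L ; 1# = 1L
    ; isCommutativeSemiring = record
      { isSemiring = record
        { isSemiringWithoutAnnihilatingZero = record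
          { +-isCommutativeMonoid = record
            { isMonoid = record
              { isSemigroup = record
                { isMagma = record { isEquivalence = Setoid.isEquivalence ≋-setoid ; ∙-cong = +L-cong }
                ; assoc = +L-assoc }
              ; identity = (λ _ → ≋-refl) , +L-identityʳ }
            ; comm = +L-comm }
          ; *-cong = *L-cong
          ; *-assoc = *L-assoc
          ; *-identity = *L-identityˡ , *L-identityʳ
          ; distrib = *L-distribˡ , (λ s p r → ≡⇒≋ (*L-distribʳ p r s)) }
        ; zero = (λ _ → ≋-refl) , (λ p → ≡⇒≋ (*L-zeroʳ p)) }
      ; *-comm = *L-comm } }

open LaurentSemiring

laurentRing : AlmostCommutativeRing 0ℓ 0ℓ
laurentRing = fromCommutativeSemiring laurent-commutativeSemiring (λ _ → nothing)

module QNumbers where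

  open import Tactic.RingSolver using (solve-∀)
  open CommutativeSemiring laurent-commutativeSemiring using (+-monoid; *-monoid)
  open ≋-Reasoning

  qint-suc : ∀ k → qint (suc k) ≋ qint k +L qpow (+ k)
  qint-suc = MonoidFolds.foldr-map-upTo-suc +-monoid (λ i → qpow (+ i))

  qfact-suc : ∀ k → qfact (suc k) ≋ qfact k *L qint (suc k)
  qfact-suc = MonoidFolds.foldr-map-upTo-suc *-monoid (λ i → qint (suc i))

  qint-+ : ∀ a b → qint (a ℕ.+ b) ≋ qint a +L qpow (+ a) *L qint b
  qint-+ a zero = begin
    qint (a ℕ.+ 0)             ≡⟨ cong qint (ℕₚ.+-identityʳ a) ⟩
    qint a                     ≈⟨ +L-identityʳ (qint a) ⟨
    qint a +L qpow (+ a) *L 0L ≡⟨ cong (qint a +L_) (*L-zeroʳ (qpow (+ a))) ⟨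
    qint a +L qpow (+ a) *L qint 0 ∎
  qint-+ a (suc b) = begin
    qint (a ℕ.+ suc b)                                      ≡⟨ cong qint (ℕₚ.+-suc a b) ⟩
    qint (suc (a ℕ.+ b))                                    ≈⟨ qint-suc (a ℕ.+ b) ⟩
    qint (a ℕ.+ b) +L qpow (+ a) *L qpow (+ b)              ≈⟨ +L-congʳ (qpow (+ a) *L qpow (+ b)) (qint-+ a b) ⟩
    (qint a +L qpow (+ a) *L qint b) +L qpow (+ a) *L qpow (+ b)
      ≈⟨ regroup (qint a) (qpow (+ a)) (qint b) (qpow (+ b)) ⟩
    qint a +L qpow (+ a) *L (qint b +L qpow (+ b))          ≈⟨ +L-congˡ (qint a) (*L-congˡ (qpow (+ a)) (qint-suc b)) ⟨
    qint a +L qpow (+ a) *L qint (suc b)                    ∎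
    where
    regroup : ∀ x y z w → (x +L y *L z) +L y *L w ≋ x +L y *L (z +L w)
    regroup = solve-∀ laurentRing

  qint-+′ : ∀ a b → qint (a ℕ.+ b) ≋ qpow (+ b) *L qint a +L qint b
  qint-+′ a b = begin
    qint (a ℕ.+ b)                  ≡⟨ cong qint (ℕₚ.+-comm a b) ⟩
    qint (b ℕ.+ a)                  ≈⟨ qint-+ b a ⟩
    qint b +L qpow (+ b) *L qint a  ≈⟨ +L-comm (qint b) (qpow (+ b) *L qint a) ⟩
    qpow (+ b) *L qint a +L qint b  ∎

module QBinomial where

  open import Tactic.RingSolver using (solve-∀)
  open ≋-Reasoning
  open QNumbers

  QBinomial : Laurent → ℕ → ℕ → Set
  QBinomial p n m = p *L (qfact n *L qfact m) ≋ qfact (n ℕ.+ m)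

  QPascal : (ℕ → ℕ → Laurent) → ℕ → ℕ → Set
  QPascal K n m = K (suc n) (suc m) ≋ K n (suc m) +L qpow (+ suc n) *L K (suc n) m
                ⊎ K (suc n) (suc m) ≋ qpow (+ suc m) *L K n (suc m) +L K (suc n) m

  qBinomial-step : ∀ n m {p} x p₁ y p₂ →
    p ≋ x *L p₁ +L y *L p₂ →
    x *L qint (suc n) +L y *L qint (suc m) ≋ qint (suc n ℕ.+ suc m) →
    QBinomial p₁ n (suc m) → QBinomial p₂ (suc n) m → QBinomial p (suc n) (suc m)
  qBinomial-step n m {p} x p₁ y p₂ p≋ qint≋ bin₁ bin₂ = begin
    p *L (qfact (suc n) *L qfact (suc m))
      ≈⟨ *L-cong p≋ (*L-cong (qfact-suc n) (qfact-suc m)) ⟩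
    (x *L p₁ +L y *L p₂) *L ((qfact n *L [n+1]) *L (qfact m *L [m+1]))
      ≈⟨ regroup x y p₁ p₂ (qfact n) (qfact m) [n+1] [m+1] ⟩
    (x *L [n+1]) *L (p₁ *L (qfact n *L (qfact m *L [m+1])))
      +L (y *L [m+1]) *L (p₂ *L ((qfact n *L [n+1]) *L qfact m))
      ≈⟨ +L-cong (*L-congˡ (x *L [n+1]) bin₁′) (*L-congˡ (y *L [m+1]) bin₂′) ⟩
    (x *L [n+1]) *L F +L (y *L [m+1]) *L F
      ≡⟨ *L-distribʳ (x *L [n+1]) (y *L [m+1]) F ⟨
    (x *L [n+1] +L y *L [m+1]) *L F
      ≈⟨ *L-congʳ F qint≋ ⟩
    qint (suc n ℕ.+ suc m) *L F
      ≈⟨ *L-comm _ F ⟩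
    F *L qint (suc (n ℕ.+ suc m))
      ≈⟨ qfact-suc (n ℕ.+ suc m) ⟨
    qfact (suc n ℕ.+ suc m) ∎
    where
    [n+1] = qint (suc n)
    [m+1] = qint (suc m)
    F = qfact (n ℕ.+ suc m)
    regroup : ∀ x y p₁ p₂ a b c d →
      (x *L p₁ +L y *L p₂) *L ((a *L c) *L (b *L d))
        ≋ (x *L c) *L (p₁ *L (a *L (b *L d))) +L (y *L d) *L (p₂ *L ((a *L c) *L b))
    regroup = solve-∀ laurentRing
    bin₁′ : p₁ *L (qfact n *L (qfact m *L [m+1])) ≋ F
    bin₁′ = ≋-trans (*L-congˡ p₁ (*L-congˡ (qfact n) (≋-sym (qfact-suc m)))) bin₁
    bin₂′ : p₂ *L ((qfact n *L [n+1]) *L qfact m) ≋ F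
    bin₂′ = ≋-trans (*L-congˡ p₂ (*L-congʳ (qfact m) (≋-sym (qfact-suc n))))
                    (≋-trans bin₂ (≡⇒≋ (cong qfact (sym (ℕₚ.+-suc n m)))))

  qPascal⇒qBinomial : (K : ℕ → ℕ → Laurent) →
    (∀ n → K n 0 ≋ 1L) → (∀ m → K 0 m ≋ 1L) → (∀ n m → QPascal K n m) →
    ∀ n m → QBinomial (K n m) n m
  qPascal⇒qBinomial K K-n0 K-0m pascal zero m = begin
    K 0 m *L (1L *L qfact m)  ≈⟨ *L-cong (K-0m m) (*L-identityˡ (qfact m)) ⟩
    1L *L qfact m             ≈⟨ *L-identityˡ (qfact m) ⟩
    qfact m                   ∎
  qPascal⇒qBinomial K K-n0 K-0m pascal (suc n) zero = begin
    K (suc n) 0 *L (qfact (suc n) *L 1L)  ≈⟨ *L-cong (K-n0 (suc n)) (*L-identityʳ (qfact (suc n))) ⟩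
    1L *L qfact (suc n)                   ≈⟨ *L-identityˡ (qfact (suc n)) ⟩
    qfact (suc n)                         ≡⟨ cong qfact (ℕₚ.+-identityʳ (suc n)) ⟨
    qfact (suc n ℕ.+ 0)                   ∎
  qPascal⇒qBinomial K K-n0 K-0m pascal (suc n) (suc m) = [ first-form , second-form ]′ (pascal n m)
    where
    step : ∀ x y → K (suc n) (suc m) ≋ x *L K n (suc m) +L y *L K (suc n) m →
      x *L qint (suc n) +L y *L qint (suc m) ≋ qint (suc n ℕ.+ suc m) →
      QBinomial (K (suc n) (suc m)) (suc n) (suc m)
    step x y K≋ qint≋ = qBinomial-step n m x (K n (suc m)) y (K (suc n) m) K≋ qint≋
      (qPascal⇒qBinomial K K-n0 K-0m pascal n (suc m))
      (qPascal⇒qBinomial K K-n0 K-0m pascal (suc n) m)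
    first-form : K (suc n) (suc m) ≋ K n (suc m) +L qpow (+ suc n) *L K (suc n) m →
      QBinomial (K (suc n) (suc m)) (suc n) (suc m)
    first-form K≋ = step 1L (qpow (+ suc n))
      (≋-trans K≋ (+L-congʳ (qpow (+ suc n) *L K (suc n) m) (≋-sym (*L-identityˡ (K n (suc m))))))
      (≋-trans (+L-congʳ (qpow (+ suc n) *L qint (suc m)) (*L-identityˡ (qint (suc n))))
               (≋-sym (qint-+ (suc n) (suc m))))
    second-form : K (suc n) (suc m) ≋ qpow (+ suc m) *L K n (suc m) +L K (suc n) m →
      QBinomial (K (suc n) (suc m)) (suc n) (suc m)
    second-form K≋ = step (qpow (+ suc m)) 1L
      (≋-trans K≋ (+L-congˡ (qpow (+ suc m) *L K n (suc m)) (≋-sym (*L-identityˡ (K (suc n) m)))))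
      (≋-trans (+L-congˡ (qpow (+ suc m) *L qint (suc n)) (*L-identityˡ (qint (suc m))))
               (≋-sym (qint-+′ (suc n) (suc m))))

module LatticePaths where

  open import Data.Bool using (true; false)
  open import Data.List using (filter)
  open import Data.List.Relation.Unary.All as All using (All; []; _∷_)
  import Data.List.Relation.Unary.All.Properties as Allₚ
  open import Relation.Nullary.Decidable using (does)
  open import Relation.Unary using (Pred; Decidable)
  open import Relation.Binary.PropositionalEquality using (subst)

  filter-map : ∀ {A B : Set} {P : Pred B 0ℓ} {Q : Pred A 0ℓ} (P? : Decidable P) (Q? : Decidable Q) (f : A → B) →
    (∀ x → does (P? (f x)) ≡ does (Q? x)) → ∀ xs → filter P? (map f xs) ≡ map f (filter Q? xs)
  filter-map P? Q? f agree [] = refl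
  filter-map P? Q? f agree (x ∷ xs) with does (P? (f x)) | does (Q? x) | agree x
  ... | true  | true  | refl = cong (f x ∷_) (filter-map P? Q? f agree xs)
  ... | false | false | refl = filter-map P? Q? f agree xs

  hasN? : ∀ c → Decidable (λ w → countN w ≡ c)
  hasN? c w = countN w ℕ.≟ c

  wordsWithN : ℕ → ℕ → List Word
  wordsWithN c k = filter (hasN? c) (allWords k)

  filter-N∷ : ∀ c ws → filter (hasN? (suc c)) (map (N ∷_) ws) ≡ map (N ∷_) (filter (hasN? c) ws)
  filter-N∷ c = filter-map (hasN? (suc c)) (hasN? c) (N ∷_) (λ _ → refl)

  filter-E∷ : ∀ c ws → filter (hasN? c) (map (E ∷_) ws) ≡ map (E ∷_) (filter (hasN? c) ws)
  filter-E∷ c = filter-map (hasN? c) (hasN? c) (E ∷_) (λ _ → refl)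

  filter-N∷-none : ∀ ws → filter (hasN? 0) (map (N ∷_) ws) ≡ []
  filter-N∷-none ws = Listₚ.filter-none (hasN? 0) (Allₚ.map⁺ (All.universal (λ _ ()) ws))

  wordsWithN-suc-suc : ∀ c k →
    wordsWithN (suc c) (suc k) ≡ map (N ∷_) (wordsWithN c k) ++ map (E ∷_) (wordsWithN (suc c) k)
  wordsWithN-suc-suc c k = trans (Listₚ.filter-++ (hasN? (suc c)) (map (N ∷_) W) (map (E ∷_) W))
                                 (cong₂ _++_ (filter-N∷ c W) (filter-E∷ (suc c) W))
    where W = allWords k

  wordsWithN-zero-suc : ∀ k → wordsWithN 0 (suc k) ≡ map (E ∷_) (wordsWithN 0 k)
  wordsWithN-zero-suc k = trans (Listₚ.filter-++ (hasN? 0) (map (N ∷_) W) (map (E ∷_) W))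
                                (cong₂ _++_ (filter-N∷-none W) (filter-E∷ 0 W))
    where W = allWords k

  countN≤length : ∀ k → All (λ w → countN w ℕ.≤ k) (allWords k)
  countN≤length zero    = ℕ.z≤n ∷ []
  countN≤length (suc k) = Allₚ.++⁺ (Allₚ.map⁺ (All.map ℕ.s≤s (countN≤length k)))
                                  (Allₚ.map⁺ (All.map ℕₚ.m≤n⇒m≤1+n (countN≤length k)))

  wordsWithN-overfull : ∀ {c k} → k ℕ.< c → wordsWithN c k ≡ []
  wordsWithN-overfull {c} {k} k<c = Listₚ.filter-none (hasN? c)
    (All.map (λ countN≤k countN≡c → ℕₚ.<⇒≱ k<c (subst (ℕ._≤ k) countN≡c countN≤k)) (countN≤length k))

  R-suc-suc : ∀ n m → R (suc n) (suc m) ≡ map (N ∷_) (R n (suc m)) ++ map (E ∷_) (R (suc n) m)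
  R-suc-suc n m = trans (wordsWithN-suc-suc n (n ℕ.+ suc m))
    (cong (λ k → map (N ∷_) (R n (suc m)) ++ map (E ∷_) (wordsWithN (suc n) k)) (ℕₚ.+-suc n m))

  R-suc-zero : ∀ n → R (suc n) 0 ≡ map (N ∷_) (R n 0)
  R-suc-zero n = begin
    R (suc n) 0
      ≡⟨ wordsWithN-suc-suc n (n ℕ.+ 0) ⟩
    map (N ∷_) (R n 0) ++ map (E ∷_) (wordsWithN (suc n) (n ℕ.+ 0))
      ≡⟨ cong (λ ws → map (N ∷_) (R n 0) ++ map (E ∷_) ws) (wordsWithN-overfull n+0<1+n) ⟩
    map (N ∷_) (R n 0) ++ []
      ≡⟨ Listₚ.++-identityʳ _ ⟩
    map (N ∷_) (R n 0) ∎
    where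
    open ≡-Reasoning
    n+0<1+n : n ℕ.+ 0 ℕ.< suc n
    n+0<1+n = ℕ.s≤s (ℕₚ.≤-reflexive (ℕₚ.+-identityʳ n))

  pred[m]∸n≡m∸[1+n] : ∀ m n → ℕ.pred m ℕ.∸ n ≡ m ℕ.∸ suc n
  pred[m]∸n≡m∸[1+n] zero    n = ℕₚ.0∸n≡0 n
  pred[m]∸n≡m∸[1+n] (suc m) n = refl

  weightFrom-N : ∀ n m x y w → weightFrom n m x (suc y) w ≡ weightFrom (ℕ.pred n) m x y w
  weightFrom-N n m x y []      = refl
  weightFrom-N n m x y (N ∷ w) = weightFrom-N n m x (suc y) w
  weightFrom-N n m x y (E ∷ w) =
    cong₂ ℤ._+_ (cong (λ d → stepWeight (d ℕ.+ (m ℕ.∸ x))) (sym (pred[m]∸n≡m∸[1+n] n y)))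
                (weightFrom-N n m (suc x) y w)

  weightFrom-E : ∀ n m x y w → weightFrom n m (suc x) y w ≡ weightFrom n (ℕ.pred m) x y w
  weightFrom-E n m x y []      = refl
  weightFrom-E n m x y (N ∷ w) = weightFrom-E n m x (suc y) w
  weightFrom-E n m x y (E ∷ w) =
    cong₂ ℤ._+_ (cong (λ d → stepWeight ((n ℕ.∸ y) ℕ.+ d)) (sym (pred[m]∸n≡m∸[1+n] m x)))
                (weightFrom-E n m (suc x) y w)

  weightSum : ℕ → ℕ → List Word → Laurent
  weightSum n m Ps = sumL (map (λ P → qpow (w' n m P)) Ps)

  weightSum-++ : ∀ n m Ps Qs → weightSum n m (Ps ++ Qs) ≡ weightSum n m Ps +L weightSum n m Qs
  weightSum-++ n m Ps Qs = trans (cong sumL (Listₚ.map-++ (λ P → qpow (w' n m P)) Ps Qs))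
                                 (sym (Listₚ.concat-++ (map (λ P → qpow (w' n m P)) Ps) _))

  weightSum-N∷ : ∀ n m Ps → weightSum (suc n) m (map (N ∷_) Ps) ≡ weightSum n m Ps
  weightSum-N∷ n m []       = refl
  weightSum-N∷ n m (P ∷ Ps) = cong₂ _+L_ (cong qpow (weightFrom-N (suc n) m 0 0 P)) (weightSum-N∷ n m Ps)

  weightSum-E∷ : ∀ n m Ps →
    weightSum n (suc m) (map (E ∷_) Ps) ≋ qpow (stepWeight (n ℕ.+ suc m)) *L weightSum n m Ps
  weightSum-E∷ n m []       = ≡⇒≋ (sym (*L-zeroʳ (qpow (stepWeight (n ℕ.+ suc m)))))
  weightSum-E∷ n m (P ∷ Ps) = begin
    qpow (s ℤ.+ weightFrom n (suc m) 1 0 P) +L weightSum n (suc m) (map (E ∷_) Ps)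
      ≈⟨ +L-cong (≡⇒≋ (cong (λ e → qpow (s ℤ.+ e)) (weightFrom-E n (suc m) 0 0 P))) (weightSum-E∷ n m Ps) ⟩
    qpow s *L qpow (w' n m P) +L qpow s *L weightSum n m Ps
      ≈⟨ *L-distribˡ (qpow s) (qpow (w' n m P)) (weightSum n m Ps) ⟨
    qpow s *L weightSum n m (P ∷ Ps) ∎
    where
    open ≋-Reasoning
    s = stepWeight (n ℕ.+ suc m)

  𝔅-suc-suc : ∀ n m → 𝔅 (suc n) (suc m) ≋ 𝔅 n (suc m) +L qpow (stepWeight (suc n ℕ.+ suc m)) *L 𝔅 (suc n) m
  𝔅-suc-suc n m = begin
    weightSum (suc n) (suc m) (R (suc n) (suc m))
      ≡⟨ cong (weightSum (suc n) (suc m)) (R-suc-suc n m) ⟩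
    weightSum (suc n) (suc m) (map (N ∷_) (R n (suc m)) ++ map (E ∷_) (R (suc n) m))
      ≡⟨ weightSum-++ (suc n) (suc m) (map (N ∷_) (R n (suc m))) _ ⟩
    weightSum (suc n) (suc m) (map (N ∷_) (R n (suc m))) +L weightSum (suc n) (suc m) (map (E ∷_) (R (suc n) m))
      ≈⟨ +L-cong (≡⇒≋ (weightSum-N∷ n (suc m) (R n (suc m)))) (weightSum-E∷ (suc n) m (R (suc n) m)) ⟩
    𝔅 n (suc m) +L qpow (stepWeight (suc n ℕ.+ suc m)) *L 𝔅 (suc n) m ∎
    where open ≋-Reasoning

  𝔅-zero-suc : ∀ m → 𝔅 0 (suc m) ≋ qpow (stepWeight (suc m)) *L 𝔅 0 m
  𝔅-zero-suc m = ≋-trans (≡⇒≋ (cong (weightSum 0 (suc m)) (wordsWithN-zero-suc m))) (weightSum-E∷ 0 m (R 0 m))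

  𝔅-suc-zero : ∀ n → 𝔅 (suc n) 0 ≡ 𝔅 n 0
  𝔅-suc-zero n = trans (cong (weightSum (suc n) 0) (R-suc-zero n)) (weightSum-N∷ n 0 (R n 0))

module Exponents where

  open import Data.Integer using (_+_; _-_; -_; -[1+_]; _/ℕ_)
  import Data.Integer.Properties as ℤₚ
  open import Data.Integer.Tactic.RingSolver using (solve-∀)
  import Data.Nat.DivMod as DivMod
  open import Data.Nat.Divisibility using (divides-refl)
  open import Data.Product using (∃-syntax)
  open ≡-Reasoning

  parity : ∀ k → ∃[ j ] (k ≡ j ℕ.+ j ⊎ k ≡ suc (j ℕ.+ j))
  parity zero = 0 , inj₁ refl
  parity (suc k) with parity k
  ... | j , inj₁ k≡j+j   = j , inj₂ (cong suc k≡j+j)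
  ... | j , inj₂ k≡1+j+j = suc j , inj₁ (cong suc (trans k≡1+j+j (sym (ℕₚ.+-suc j j))))

  j+j≡j*2 : ∀ j → j ℕ.+ j ≡ j ℕ.* 2
  j+j≡j*2 j = trans (cong (j ℕ.+_) (sym (ℕₚ.+-identityʳ j))) (ℕₚ.*-comm 2 j)

  [j+j]%2≡0 : ∀ j → (j ℕ.+ j) ℕ.% 2 ≡ 0
  [j+j]%2≡0 j = trans (cong (ℕ._% 2) (j+j≡j*2 j)) (DivMod.m*n%n≡0 j 2)

  [j+j]/2≡j : ∀ j → (j ℕ.+ j) ℕ./ 2 ≡ j
  [j+j]/2≡j j = trans (cong (ℕ._/ 2) (j+j≡j*2 j)) (DivMod.m*n/n≡m j 2)

  [1+j+j]%2≡1 : ∀ j → suc (j ℕ.+ j) ℕ.% 2 ≡ 1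
  [1+j+j]%2≡1 j = trans (cong (λ x → suc x ℕ.% 2) (j+j≡j*2 j)) (DivMod.[m+kn]%n≡m%n 1 j 2)

  [1+j+j]/2≡j : ∀ j → suc (j ℕ.+ j) ℕ./ 2 ≡ j
  [1+j+j]/2≡j j = begin
    suc (j ℕ.+ j) ℕ./ 2  ≡⟨ cong (λ x → suc x ℕ./ 2) (j+j≡j*2 j) ⟩
    suc (j ℕ.* 2) ℕ./ 2  ≡⟨ DivMod.+-distrib-/-∣ʳ 1 {d = 2} (divides-refl j) ⟩
    j ℕ.* 2 ℕ./ 2        ≡⟨ DivMod.m*n/n≡m j 2 ⟩
    j                    ∎

  [t+t]/ℕ2≡t : ∀ t → (t + t) /ℕ 2 ≡ t
  [t+t]/ℕ2≡t (+ j)    = cong +_ ([j+j]/2≡j j)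
  -- On a negative dividend _/ℕ_ branches on a remainder in ℕ, which the rewrite evaluates.
  [t+t]/ℕ2≡t -[1+ j ] rewrite [j+j]%2≡0 j =
    cong (λ x → - (+ x)) (trans (cong (λ x → suc x ℕ./ 2) (sym (ℕₚ.+-suc j j))) ([j+j]/2≡j (suc j)))

  [t+t+1]/ℕ2≡t : ∀ t → (t + t + + 1) /ℕ 2 ≡ t
  [t+t+1]/ℕ2≡t (+ j)    = cong +_ (trans (cong (ℕ._/ 2) (ℕₚ.+-comm (j ℕ.+ j) 1)) ([1+j+j]/2≡j j))
  [t+t+1]/ℕ2≡t -[1+ j ] rewrite [1+j+j]%2≡1 j = cong -[1+_] ([1+j+j]/2≡j j)

  stepWeight-even : ∀ j → stepWeight (j ℕ.+ j) ≡ + j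
  stepWeight-even j rewrite [j+j]%2≡0 j = cong +_ ([j+j]/2≡j j)

  stepWeight-odd : ∀ j → stepWeight (suc (j ℕ.+ j)) ≡ - + j
  stepWeight-odd j rewrite [1+j+j]%2≡1 j = cong (λ x → - (+ x)) ([j+j]/2≡j j)

  +n≡+[n+m]-+m : ∀ {n m k} → n ℕ.+ m ≡ k → + n ≡ + k - + m
  +n≡+[n+m]-+m {n} {m} refl = cancel (+ n) (+ m)
    where
    cancel : ∀ N M → N ≡ (N + M) - M
    cancel = solve-∀

  D-even : ∀ n m j → n ℕ.+ m ≡ j ℕ.+ j → D n m ≡ + j - + m
  D-even n m j n+m≡j+j = begin
    ((+ n - + m) + + 1) /ℕ 2
      ≡⟨ cong (λ x → ((x - + m) + + 1) /ℕ 2) (+n≡+[n+m]-+m n+m≡j+j) ⟩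
    (((+ j + + j) - + m - + m) + + 1) /ℕ 2
      ≡⟨ cong (_/ℕ 2) (regroup (+ j) (+ m)) ⟩
    ((+ j - + m) + (+ j - + m) + + 1) /ℕ 2
      ≡⟨ [t+t+1]/ℕ2≡t (+ j - + m) ⟩
    + j - + m ∎
    where
    regroup : ∀ J M → ((J + J) - M - M) + + 1 ≡ (J - M) + (J - M) + + 1
    regroup = solve-∀

  D-odd : ∀ n m j → n ℕ.+ m ≡ suc (j ℕ.+ j) → D n m ≡ + 1 + (+ j - + m)
  D-odd n m j n+m≡1+j+j = begin
    ((+ n - + m) + + 1) /ℕ 2
      ≡⟨ cong (λ x → ((x - + m) + + 1) /ℕ 2) (+n≡+[n+m]-+m n+m≡1+j+j) ⟩
    (((+ 1 + (+ j + + j)) - + m - + m) + + 1) /ℕ 2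
      ≡⟨ cong (_/ℕ 2) (regroup (+ j) (+ m)) ⟩
    ((+ 1 + (+ j - + m)) + (+ 1 + (+ j - + m))) /ℕ 2
      ≡⟨ [t+t]/ℕ2≡t (+ 1 + (+ j - + m)) ⟩
    + 1 + (+ j - + m) ∎
    where
    regroup : ∀ J M → ((+ 1 + (J + J)) - M - M) + + 1 ≡ (+ 1 + (J - M)) + (+ 1 + (J - M))
    regroup = solve-∀

  consecutiveSum : ℤ → ℕ → ℤ
  consecutiveSum a m = foldr _+_ (+ 0) (map (λ i → a + + i) (upTo m))

  -v≡consecutiveSum : ∀ n m {a} → D n m ≡ a → - v n m ≡ consecutiveSum a m
  -v≡consecutiveSum n m refl = ℤₚ.neg-involutive _

  consecutiveSum-suc : ∀ a m → consecutiveSum a (suc m) ≡ consecutiveSum a m + (a + + m)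
  consecutiveSum-suc a = MonoidFolds.foldr-map-upTo-suc ℤₚ.+-0-monoid (λ i → a + + i)

  consecutiveSum-1+ : ∀ a m → consecutiveSum (+ 1 + a) m ≡ + m + consecutiveSum a m
  consecutiveSum-1+ a zero    = refl
  consecutiveSum-1+ a (suc m) = begin
    consecutiveSum (+ 1 + a) (suc m)
      ≡⟨ consecutiveSum-suc (+ 1 + a) m ⟩
    consecutiveSum (+ 1 + a) m + ((+ 1 + a) + + m)
      ≡⟨ cong (λ x → x + ((+ 1 + a) + + m)) (consecutiveSum-1+ a m) ⟩
    (+ m + consecutiveSum a m) + ((+ 1 + a) + + m)
      ≡⟨ regroup (+ m) (consecutiveSum a m) a ⟩
    (+ 1 + + m) + (consecutiveSum a m + (a + + m))
      ≡⟨ cong (λ x → (+ 1 + + m) + x) (consecutiveSum-suc a m) ⟨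
    + suc m + consecutiveSum a (suc m) ∎
    where
    regroup : ∀ M S A → (M + S) + ((+ 1 + A) + M) ≡ (+ 1 + M) + (S + (A + M))
    regroup = solve-∀

  -v-N-even : ∀ n m j → n ℕ.+ m ≡ j ℕ.+ j → - v (suc n) m ≡ + m + - v n m
  -v-N-even n m j n+m≡j+j = begin
    - v (suc n) m
      ≡⟨ -v≡consecutiveSum (suc n) m (D-odd (suc n) m j (cong suc n+m≡j+j)) ⟩
    consecutiveSum (+ 1 + (+ j - + m)) m
      ≡⟨ consecutiveSum-1+ (+ j - + m) m ⟩
    + m + consecutiveSum (+ j - + m) m
      ≡⟨ cong (λ x → + m + x) (-v≡consecutiveSum n m (D-even n m j n+m≡j+j)) ⟨
    + m + - v n m ∎

  -v-N-odd : ∀ n m j → n ℕ.+ m ≡ suc (j ℕ.+ j) → - v (suc n) m ≡ - v n m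
  -v-N-odd n m j n+m≡1+j+j = begin
    - v (suc n) m
      ≡⟨ -v≡consecutiveSum (suc n) m (D-even (suc n) m (suc j) 1+n+m≡1+j+1+j) ⟩
    consecutiveSum ((+ 1 + + j) - + m) m
      ≡⟨ cong (λ a → consecutiveSum a m) (ℤₚ.+-assoc (+ 1) (+ j) (- + m)) ⟩
    consecutiveSum (+ 1 + (+ j - + m)) m
      ≡⟨ -v≡consecutiveSum n m (D-odd n m j n+m≡1+j+j) ⟨
    - v n m ∎
    where
    1+n+m≡1+j+1+j : suc n ℕ.+ m ≡ suc j ℕ.+ suc j
    1+n+m≡1+j+1+j = cong suc (trans n+m≡1+j+j (sym (ℕₚ.+-suc j j)))

  -v-E-even : ∀ n m j → n ℕ.+ m ≡ j ℕ.+ j → - v n (suc m) + stepWeight (n ℕ.+ suc m) ≡ - v n m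
  -v-E-even n m j n+m≡j+j = begin
    - v n (suc m) + stepWeight (n ℕ.+ suc m)
      ≡⟨ cong₂ _+_ (-v≡consecutiveSum n (suc m) (trans (D-odd n (suc m) j n+1+m≡1+j+j) (cancel (+ j) (+ m))))
                   (trans (cong stepWeight n+1+m≡1+j+j) (stepWeight-odd j)) ⟩
    consecutiveSum t (suc m) + - + j
      ≡⟨ cong (λ x → x + - + j) (consecutiveSum-suc t m) ⟩
    (consecutiveSum t m + (t + + m)) + - + j
      ≡⟨ regroup (consecutiveSum t m) (+ j) (+ m) ⟩
    consecutiveSum t m
      ≡⟨ -v≡consecutiveSum n m (D-even n m j n+m≡j+j) ⟨
    - v n m ∎
    where
    t = + j - + m
    n+1+m≡1+j+j : n ℕ.+ suc m ≡ suc (j ℕ.+ j)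
    n+1+m≡1+j+j = trans (ℕₚ.+-suc n m) (cong suc n+m≡j+j)
    cancel : ∀ J M → + 1 + (J - (+ 1 + M)) ≡ J - M
    cancel = solve-∀
    regroup : ∀ S J M → (S + ((J - M) + M)) + - J ≡ S
    regroup = solve-∀

  -v-E-odd : ∀ n m j → n ℕ.+ m ≡ suc (j ℕ.+ j) → - v n (suc m) + stepWeight (n ℕ.+ suc m) ≡ + n + - v n m
  -v-E-odd n m j n+m≡1+j+j = begin
    - v n (suc m) + stepWeight (n ℕ.+ suc m)
      ≡⟨ cong₂ _+_ (-v≡consecutiveSum n (suc m) (trans (D-even n (suc m) (suc j) n+1+m≡1+j+1+j) (cancel (+ j) (+ m))))
                   (trans (cong stepWeight n+1+m≡1+j+1+j) (stepWeight-even (suc j))) ⟩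
    consecutiveSum t (suc m) + (+ 1 + + j)
      ≡⟨ cong (λ x → x + (+ 1 + + j)) (consecutiveSum-suc t m) ⟩
    (consecutiveSum t m + (t + + m)) + (+ 1 + + j)
      ≡⟨ regroup (consecutiveSum t m) (+ j) (+ m) ⟩
    ((+ 1 + (+ j + + j)) - + m) + (+ m + consecutiveSum t m)
      ≡⟨ cong₂ _+_ (+n≡+[n+m]-+m n+m≡1+j+j)
                   (trans (-v≡consecutiveSum n m (D-odd n m j n+m≡1+j+j)) (consecutiveSum-1+ t m)) ⟨
    + n + - v n m ∎
    where
    t = + j - + m
    n+1+m≡1+j+1+j : n ℕ.+ suc m ≡ suc j ℕ.+ suc j
    n+1+m≡1+j+1+j = trans (ℕₚ.+-suc n m) (cong suc (trans n+m≡1+j+j (sym (ℕₚ.+-suc j j))))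
    cancel : ∀ J M → (+ 1 + J) - (+ 1 + M) ≡ J - M
    cancel = solve-∀
    regroup : ∀ S J M → (S + ((J - M) + M)) + (+ 1 + J) ≡ ((+ 1 + (J + J)) - M) + (M + S)
    regroup = solve-∀

  -v-suc-suc : ∀ n m →
      (- v (suc n) (suc m) ≡ + 0 + - v n (suc m)
        × - v (suc n) (suc m) + stepWeight (suc n ℕ.+ suc m) ≡ + suc n + - v (suc n) m)
    ⊎ (- v (suc n) (suc m) ≡ + suc m + - v n (suc m)
        × - v (suc n) (suc m) + stepWeight (suc n ℕ.+ suc m) ≡ + 0 + - v (suc n) m)
  -v-suc-suc n m with parity (n ℕ.+ m)
  ... | j , inj₁ n+m≡j+j   = inj₁ ( trans (-v-N-odd n (suc m) j n+1+m≡1+j+j) (sym (ℤₚ.+-identityˡ _))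
                                  , -v-E-odd (suc n) m j (cong suc n+m≡j+j) )
    where
    n+1+m≡1+j+j : n ℕ.+ suc m ≡ suc (j ℕ.+ j)
    n+1+m≡1+j+j = trans (ℕₚ.+-suc n m) (cong suc n+m≡j+j)
  ... | j , inj₂ n+m≡1+j+j = inj₂ ( -v-N-even n (suc m) (suc j) n+1+m≡1+j+1+j
                                  , trans (-v-E-even (suc n) m (suc j) 1+n+m≡1+j+1+j) (sym (ℤₚ.+-identityˡ _)) )
    where
    1+n+m≡1+j+1+j : suc n ℕ.+ m ≡ suc j ℕ.+ suc j
    1+n+m≡1+j+1+j = cong suc (trans n+m≡1+j+j (sym (ℕₚ.+-suc j j)))
    n+1+m≡1+j+1+j : n ℕ.+ suc m ≡ suc j ℕ.+ suc j
    n+1+m≡1+j+1+j = trans (ℕₚ.+-suc n m) 1+n+m≡1+j+1+j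

  -v-zero-suc : ∀ m → - v 0 (suc m) + stepWeight (suc m) ≡ - v 0 m
  -v-zero-suc m with parity m
  ... | j , inj₁ m≡j+j   = -v-E-even 0 m j m≡j+j
  ... | j , inj₂ m≡1+j+j = trans (-v-E-odd 0 m j m≡1+j+j) (ℤₚ.+-identityˡ _)

open QBinomial
open LatticePaths
open Exponents

K : ℕ → ℕ → Laurent
K n m = qpow (ℤ.- v n m) *L 𝔅 n m

K-zero-suc : ∀ m → K 0 (suc m) ≋ K 0 m
K-zero-suc m = begin
  qpow V *L 𝔅 0 (suc m)                 ≈⟨ *L-congˡ (qpow V) (𝔅-zero-suc m) ⟩
  qpow V *L (qpow s *L 𝔅 0 m)           ≈⟨ *L-assoc (qpow V) (qpow s) (𝔅 0 m) ⟨
  qpow (V ℤ.+ s) *L 𝔅 0 m               ≡⟨ cong (λ e → qpow e *L 𝔅 0 m) (-v-zero-suc m) ⟩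
  K 0 m                                 ∎
  where
  open ≋-Reasoning
  V = ℤ.- v 0 (suc m)
  s = stepWeight (suc m)

K-suc-suc : ∀ n m a b →
  ℤ.- v (suc n) (suc m) ≡ a ℤ.+ ℤ.- v n (suc m) →
  ℤ.- v (suc n) (suc m) ℤ.+ stepWeight (suc n ℕ.+ suc m) ≡ b ℤ.+ ℤ.- v (suc n) m →
  K (suc n) (suc m) ≋ qpow a *L K n (suc m) +L qpow b *L K (suc n) m
K-suc-suc n m a b V≡ V+s≡ = begin
  qpow V *L 𝔅 (suc n) (suc m)
    ≈⟨ *L-congˡ (qpow V) (𝔅-suc-suc n m) ⟩
  qpow V *L (𝔅 n (suc m) +L qpow s *L 𝔅 (suc n) m)
    ≈⟨ *L-distribˡ (qpow V) (𝔅 n (suc m)) (qpow s *L 𝔅 (suc n) m) ⟩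
  qpow V *L 𝔅 n (suc m) +L qpow V *L (qpow s *L 𝔅 (suc n) m)
    ≈⟨ +L-congˡ (qpow V *L 𝔅 n (suc m)) (*L-assoc (qpow V) (qpow s) (𝔅 (suc n) m)) ⟨
  qpow V *L 𝔅 n (suc m) +L qpow (V ℤ.+ s) *L 𝔅 (suc n) m
    ≡⟨ cong₂ (λ e f → qpow e *L 𝔅 n (suc m) +L qpow f *L 𝔅 (suc n) m) V≡ V+s≡ ⟩
  qpow (a ℤ.+ ℤ.- v n (suc m)) *L 𝔅 n (suc m) +L qpow (b ℤ.+ ℤ.- v (suc n) m) *L 𝔅 (suc n) m
    ≈⟨ +L-cong (*L-assoc (qpow a) (qpow (ℤ.- v n (suc m))) (𝔅 n (suc m)))
               (*L-assoc (qpow b) (qpow (ℤ.- v (suc n) m)) (𝔅 (suc n) m)) ⟩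
  qpow a *L K n (suc m) +L qpow b *L K (suc n) m ∎
  where
  open ≋-Reasoning
  V = ℤ.- v (suc n) (suc m)
  s = stepWeight (suc n ℕ.+ suc m)

K-qPascal : ∀ n m → QPascal K n m
K-qPascal n m with -v-suc-suc n m
... | inj₁ (V≡ , V+s≡) = inj₁ (≋-trans (K-suc-suc n m (+ 0) (+ suc n) V≡ V+s≡)
                                       (+L-congʳ (qpow (+ suc n) *L K (suc n) m) (*L-identityˡ (K n (suc m)))))
... | inj₂ (V≡ , V+s≡) = inj₂ (≋-trans (K-suc-suc n m (+ suc m) (+ 0) V≡ V+s≡)
                                       (+L-congˡ (qpow (+ suc m) *L K n (suc m)) (*L-identityˡ (K (suc n) m))))

K-n-zero : ∀ n → K n 0 ≋ 1L
K-n-zero zero    = ≋-refl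
K-n-zero (suc n) = ≋-trans (≡⇒≋ (cong (qpow (+ 0) *L_) (𝔅-suc-zero n))) (K-n-zero n)

K-zero-m : ∀ m → K 0 m ≋ 1L
K-zero-m zero    = ≋-refl
K-zero-m (suc m) = ≋-trans (K-zero-suc m) (K-zero-m m)

open import Data.Nat using (_+_)
open import Data.Integer using (-_)

theorem5p8 : (n m : ℕ) →
    qpow (- v n m) *L 𝔅 n m *L (qfact n *L qfact m) ≈L qfact (n + m)
theorem5p8 n m = coeff-≡ (qPascal⇒qBinomial K K-n-zero K-zero-m K-qPascal n m)
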